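{- For any binary string $S$, $VCdim(2^S)\leq 2$.
   Context: Binary strings are indexed from $0$ and identified via $n(S)=\{i: S_i=1\}$. For a binary string $S$, $2^S$ is the binary string with $n(2^S)=\{2^i: S_i=1\}$, i.e. $2^S$ has a $1$ at index $j$ iff $j=2^i$ for some $i$ with $S_i=1$. For a binary string $T$, let $\mathfrak{T}=\{n(s): s \text{ a finite contiguous substring of } T\}$ (indices of $s$ taken relative to $s$); a set $B\subseteq\mathbb{N}$ is shattered if $\{c\cap B: c\in\mathfrak{T}\}$ is the power set of $B$; $VCdim(T)$ is the largest size of a shattered set. -}

module Defs where

open import Data.Nat using (ℕ; _+_; _^_; _<_; _≤_)
open import Data.Bool using (Bool; true)
open import Data.Product using (Σ; ∃; ∃-syntax; _×_)
open import Data.List using (List; length)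
open import Data.List.Membership.Propositional using (_∈_)
open import Data.List.Relation.Unary.Unique.Propositional using (Unique)
open import Function.Bundles using (_⇔_)
open import Relation.Binary.PropositionalEquality using (_≡_)

BinString : Set
BinString = ℕ → Bool

n : BinString → ℕ → Set
n S i = S i ≡ true

-- T is the string 2^S : n(2^S) = { 2^i : S_i = 1 }.
IsPow2String : BinString → BinString → Set
IsPow2String S T = ∀ j → (n T j ⇔ (∃[ i ] (j ≡ 2 ^ i × n S i)))

-- n(s) for the contiguous substring s of T starting at position p with
-- length l (indices relative to s): { k : k < l and T_(p+k) = 1 }.
nSub : BinString → ℕ → ℕ → ℕ → Set
nSub T p l k = k < l × n T (p + k)

-- The finite set B (a duplicate-free list) is shattered by the substrings
-- of T: every subset C of B (given by a characteristic function χ) is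
-- c ∩ B for some c = n(s), s a finite contiguous substring of T.
Shattered : BinString → List ℕ → Set
Shattered T B =
  (χ : ℕ → Bool) → ∃[ p ] ∃[ l ] (∀ b → b ∈ B → (χ b ≡ true ⇔ nSub T p l b))

VCdim≤ : BinString → ℕ → Set
VCdim≤ T d = (B : List ℕ) → Unique B → Shattered T B → length B ≤ d

-- The ones of 2^S sit only at powers of two. If the substring starting at p
-- has ones at relative positions x < z, then z − x = 2^k − 2^i, and a positive
-- difference of two powers of two determines both of them; so p + z = 2^k,
-- and hence the start p, is determined by x and z. For x < y < z, a substring
-- realising {x, z} therefore starts where one realising {x, y, z} does and
-- also contains y: no three-element set is shattered.
module Submission where

open import Defs
open import Data.Nat using (ℕ; zero; suc; _+_; _*_; _^_; _<_; _≟_; _<?_; z≤n; s≤s)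
open import Data.Nat.Properties
open import Data.Bool using (true; not)
open import Data.Product using (∃-syntax; _×_; _,_)
open import Data.List using (_∷_; [])
open import Data.List.Membership.Propositional using (_∈_)
open import Data.List.Relation.Unary.Any using (here; there)
open import Data.List.Relation.Unary.AllPairs using (_∷_)
open import Data.List.Relation.Unary.All using (_∷_)
open import Data.Empty using (⊥-elim)
open import Function.Bundles using (Equivalence)
open import Relation.Binary.Definitions using (tri<; tri≈; tri>)
open import Relation.Binary.PropositionalEquality
open import Relation.Nullary using (¬_; yes; no; does; contradiction)
open import Relation.Nullary.Decidable using (dec-true; dec-false)
open import Data.Nat.Tactic.RingSolver using (solve-∀)

private
  1<2 : 1 < 2
  1<2 = s≤s (s≤s z≤n)

2^-cancel-< : ∀ {i k} → 2 ^ i < 2 ^ k → i < k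
2^-cancel-< {i} {k} lt with i <? k
... | yes i<k = i<k
... | no  i≮k = contradiction (^-monoʳ-≤ 2 (≮⇒≥ i≮k)) (<⇒≱ lt)

2^-injective : ∀ {i k} → 2 ^ i ≡ 2 ^ k → i ≡ k
2^-injective {i} {k} e with <-cmp i k
... | tri< i<k _ _ = contradiction e (<⇒≢ (^-monoʳ-< 2 1<2 i<k))
... | tri≈ _ i≡k _ = i≡k
... | tri> _ _ k<i = contradiction (sym e) (<⇒≢ (^-monoʳ-< 2 1<2 k<i))

2^suc+1≢2^suc+2^suc : ∀ k c i → 2 ^ suc k + 1 ≢ 2 ^ suc c + 2 ^ suc i
2^suc+1≢2^suc+2^suc k c i e = even≢odd (2 ^ c + 2 ^ i) (2 ^ k) (begin
  2 * (2 ^ c + 2 ^ i)      ≡⟨ *-distribˡ-+ 2 (2 ^ c) (2 ^ i) ⟩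
  2 ^ suc c + 2 ^ suc i    ≡⟨ sym e ⟩
  2 ^ suc k + 1            ≡⟨ +-comm (2 ^ suc k) 1 ⟩
  suc (2 * 2 ^ k)          ∎)
  where open ≡-Reasoning

-- Stated with both sides moved so that no subtraction occurs:
-- 2^k − 2^i = 2^c − 2^a with i < k and a < c forces k = c.
2^-difference-injective : ∀ {i k a c} → i < k → a < c →
                          2 ^ k + 2 ^ a ≡ 2 ^ c + 2 ^ i → k ≡ c
2^-difference-injective {zero}  {k}     {zero}  {c}     _         _         e =
  2^-injective (+-cancelʳ-≡ 1 (2 ^ k) (2 ^ c) e)
2^-difference-injective {suc i} {suc k} {suc a} {suc c} (s≤s i<k) (s≤s a<c) e =
  cong suc (2^-difference-injective i<k a<c (*-cancelˡ-≡ _ _ 2 (begin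
    2 * (2 ^ k + 2 ^ a)      ≡⟨ *-distribˡ-+ 2 (2 ^ k) (2 ^ a) ⟩
    2 ^ suc k + 2 ^ suc a    ≡⟨ e ⟩
    2 ^ suc c + 2 ^ suc i    ≡⟨ sym (*-distribˡ-+ 2 (2 ^ c) (2 ^ i)) ⟩
    2 * (2 ^ c + 2 ^ i)      ∎)))
  where open ≡-Reasoning
2^-difference-injective {suc i} {suc k} {zero}  {suc c} _ _ e =
  contradiction e (2^suc+1≢2^suc+2^suc k c i)
2^-difference-injective {zero}  {suc k} {suc a} {suc c} _ _ e =
  contradiction (sym e) (2^suc+1≢2^suc+2^suc c k a)

OnesAtPowersOfTwo : BinString → Set
OnesAtPowersOfTwo T = ∀ j → n T j → ∃[ i ] j ≡ 2 ^ i

IsPow2String⇒OnesAtPowersOfTwo : ∀ {S T} → IsPow2String S T → OnesAtPowersOfTwo T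
IsPow2String⇒OnesAtPowersOfTwo H j t with Equivalence.to (H j) t
... | i , j≡2^i , _ = i , j≡2^i

module _ {T : BinString} (ones : OnesAtPowersOfTwo T) where

  window-determined : ∀ {x z p q} → x < z →
                      n T (p + x) → n T (p + z) → n T (q + x) → n T (q + z) → p ≡ q
  window-determined {x} {z} {p} {q} x<z px pz qx qz
    with ones _ px | ones _ pz | ones _ qx | ones _ qz
  ... | i , ei | k , ek | a , ea | c , ec = +-cancelʳ-≡ z p q (begin
    p + z    ≡⟨ ek ⟩
    2 ^ k    ≡⟨ cong (2 ^_) k≡c ⟩
    2 ^ c    ≡⟨ sym ec ⟩
    q + z    ∎)
    where
    open ≡-Reasoning
    k≡c : k ≡ c
    k≡c = 2^-difference-injective
      (2^-cancel-< {i} {k} (subst₂ _<_ ei ek (+-monoʳ-< p x<z)))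
      (2^-cancel-< {a} {c} (subst₂ _<_ ea ec (+-monoʳ-< q x<z)))
      (subst₂ _≡_ (cong₂ _+_ ek ea) (cong₂ _+_ ec ei)
        (+-comm-middle p z q x))
      where
      +-comm-middle : ∀ p z q x → (p + z) + (q + x) ≡ (q + z) + (p + x)
      +-comm-middle = solve-∀

  ¬shattered-triple : ∀ {B x y z} → x < y → y < z → x ∈ B → y ∈ B → z ∈ B →
                      ¬ Shattered T B
  ¬shattered-triple {x = x} {y} {z} x<y y<z x∈B y∈B z∈B shatters
    with shatters (λ _ → true) | shatters (λ b → not (does (b ≟ y)))
  ... | p , _ , all | q , _ , skip-y
    with Equivalence.to (all x x∈B) refl
       | Equivalence.to (all y y∈B) refl
       | Equivalence.to (all z z∈B) refl
       | Equivalence.to (skip-y x x∈B) (cong not (dec-false (x ≟ y) (<⇒≢ x<y)))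
       | Equivalence.to (skip-y z z∈B) (cong not (dec-false (z ≟ y) (>⇒≢ y<z)))
  ... | _ , px | _ , py | _ , pz | _ , qx | z<l , qz
    with window-determined (<-trans x<y y<z) px pz qx qz
  ... | refl = contradiction (Equivalence.from (skip-y y y∈B) (<-trans y<z z<l , py)) y-skipped
    where
    y-skipped : not (does (y ≟ y)) ≢ true
    y-skipped rewrite dec-true (y ≟ y) refl = λ ()

sort-distinct₃ : ∀ {P : ℕ → Set} {x y z} → x ≢ y → x ≢ z → y ≢ z →
                 P x → P y → P z → ∃[ u ] ∃[ v ] ∃[ w ] (u < v × v < w × P u × P v × P w)
sort-distinct₃ {x = x} {y} {z} x≢y x≢z y≢z px py pz with <-cmp x y | <-cmp y z | <-cmp x z
... | tri≈ _ e _ | _ | _ = contradiction e x≢y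
... | _ | tri≈ _ e _ | _ = contradiction e y≢z
... | _ | _ | tri≈ _ e _ = contradiction e x≢z
... | tri< x<y _ _ | tri< y<z _ _ | _            = x , y , z , x<y , y<z , px , py , pz
... | tri< _ _ _   | tri> _ _ z<y | tri< x<z _ _ = x , z , y , x<z , z<y , px , pz , py
... | tri< x<y _ _ | tri> _ _ _   | tri> _ _ z<x = z , x , y , z<x , x<y , pz , px , py
... | tri> _ _ y<x | tri< _ _ _   | tri< x<z _ _ = y , x , z , y<x , x<z , py , px , pz
... | tri> _ _ _   | tri< y<z _ _ | tri> _ _ z<x = y , z , x , y<z , z<x , py , pz , px
... | tri> _ _ y<x | tri> _ _ z<y | _            = z , y , x , z<y , y<x , pz , py , px

proposition7 : (S T : BinString) → IsPow2String S T → VCdim≤ T 2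
proposition7 S T H []              _ _ = z≤n
proposition7 S T H (_ ∷ [])        _ _ = s≤s z≤n
proposition7 S T H (_ ∷ _ ∷ [])    _ _ = s≤s (s≤s z≤n)
proposition7 S T H B@(x ∷ y ∷ z ∷ _) ((x≢y ∷ x≢z ∷ _) ∷ (y≢z ∷ _) ∷ _) shatters
  with sort-distinct₃ {P = _∈ B} x≢y x≢z y≢z (here refl) (there (here refl)) (there (there (here refl)))
... | _ , _ , _ , u<v , v<w , u∈B , v∈B , w∈B =
  ⊥-elim (¬shattered-triple (IsPow2String⇒OnesAtPowersOfTwo H) u<v v<w u∈B v∈B w∈B shatters)
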